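{- Let $G$ be a core graph on nine vertices in which every vertex has degree at least $3$ and at most $5$. Suppose $G$ contains a $5$-hole $v_1v_2v_3v_4v_5$ and the other four vertices are $u_1,u_2,u_3,u_4$, where for each $i$ the neighbours of $u_i$ on the hole are $v_{i+2}$, $v_{i+3}$ and possibly $v_i$ (indices modulo $5$). If $u_iu_{i+1}\in E(G)$ for all $i=1,2,3$, then $G$ is an induced subgraph of a $(3,3)$-partitionable graph.
   Context: All graphs are finite and simple. A $5$-hole is an induced $5$-cycle. For integers $p,q\ge2$, a graph is $(p,q)$-partitionable if it has $pq+1$ vertices and for every vertex $v$, the remaining vertices can be partitioned into $q$ independent sets of size $p$ and also into $p$ cliques of size $q$. For a graph $G$, let $P(G)$ be the polytope in $\mathbb{R}^{V(G)}$ defined by $0\le x_v\le 1$, $x_u+x_v\le1$ for every edge $uv$, and $\sum_{v\in V(C)}x_v\le(|V(C)|-1)/2$ for every induced odd cycle $C$; $G$ is t-perfect if $P(G)$ equals the convex hull of characteristic vectors of independent sets, t-imperfect otherwise. If $N(v)$ is independent, the t-contraction at $v$ contracts $N(v)\cup\{v\}$ to one vertex. A t-minor is obtained by vertex deletions and t-contractions; proper if it has fewer vertices. A core graph is a graph $G$ such that neither $G$ nor $\overline{G}$ has a t-imperfect proper t-minor. -}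

module Defs where

open import Data.Bool using (Bool; true; false; not; _∧_; if_then_else_)
open import Data.Nat as ℕ using (ℕ; zero; suc; _∸_; _≤_; _<_; _*_)
open import Data.Nat.DivMod using (_mod_)
open import Data.Fin using (Fin; toℕ; _≟_)
open import Data.List using (List; []; _∷_; length; lookup; filterᵇ; allFin)
open import Data.Bool.ListAction using (any)
open import Data.Product using (Σ; ∃; _×_; _,_; proj₁; proj₂)
open import Data.Sum using (_⊎_)
open import Data.Integer using (+_)
open import Data.Rational as ℚ using (ℚ; 0ℚ; 1ℚ; _/_)
open import Relation.Binary.PropositionalEquality using (_≡_; _≢_)
open import Relation.Nullary using (¬_; ⌊_⌋)

Graph : ℕ → Set
Graph n = Fin n → Fin n → Bool

Gr : Set
Gr = Σ ℕ Graph

Edge : ∀ {n} → Graph n → Fin n → Fin n → Set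
Edge G i j = G i j ≡ true

IsSimple : ∀ {n} → Graph n → Set
IsSimple G = (∀ i j → G i j ≡ G j i) × (∀ i → G i i ≡ false)

deg : ∀ {n} → Graph n → Fin n → ℕ
deg {n} G i = length (filterᵇ (G i) (allFin n))

complement : ∀ {n} → Graph n → Graph n
complement G i j = not (G i j) ∧ not ⌊ i ≟ j ⌋

induced : ∀ {n} → Graph n → (Fin n → Bool) → Gr
induced {n} G keep =
  length l , λ i j → G (lookup l i) (lookup l j)
  where l = filterᵇ keep (allFin n)

delete : ∀ {n} → Graph n → Fin n → Gr
delete G v = induced G (λ i → not ⌊ i ≟ v ⌋)

NbhdIndependent : ∀ {n} → Graph n → Fin n → Set
NbhdIndependent G v = ∀ a b → G v a ≡ true → G v b ≡ true → G a b ≡ false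

-- t-contraction at v: N(v) ∪ {v} is replaced by the single vertex v, which
-- becomes adjacent to every vertex outside N(v) ∪ {v} having a neighbour
-- in N(v); afterwards the vertices of N(v) are deleted.
contract : ∀ {n} → Graph n → Fin n → Gr
contract {n} G v = induced G' (λ i → not (G v i))
  where
  c : Fin n → Bool
  c x = not (G v x) ∧ not ⌊ x ≟ v ⌋ ∧ any (λ a → G v a ∧ G a x) (allFin n)
  G' : Graph n
  G' i j = if ⌊ i ≟ v ⌋ then c j else (if ⌊ j ≟ v ⌋ then c i else G i j)

data TMinor : Gr → Gr → Set where
  tm-refl : ∀ {H} → TMinor H H
  tm-del  : ∀ {H n} {G : Graph n} (v : Fin n) →
            TMinor H (delete G v) → TMinor H (n , G)
  tm-con  : ∀ {H n} {G : Graph n} (v : Fin n) → NbhdIndependent G v →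
            TMinor H (contract G v) → TMinor H (n , G)

ProperTMinor : Gr → Gr → Set
ProperTMinor H G = TMinor H G × proj₁ H < proj₁ G

-- t-perfection (polytopes described through their rational points)

sumFin : ∀ {n} → (Fin n → ℚ) → ℚ
sumFin {n} f = Data.List.foldr (λ i s → f i ℚ.+ s) 0ℚ (allFin n)
  where import Data.List

sumList : ∀ {A : Set} → (A → ℚ) → List A → ℚ
sumList f [] = 0ℚ
sumList f (a ∷ as) = f a ℚ.+ sumList f as


Consec : ∀ {k} .{{_ : ℕ.NonZero k}} → Fin k → Fin k → Set
Consec {k} i j = j ≡ (suc (toℕ i) mod k) ⊎ i ≡ (suc (toℕ j) mod k)

record InducedOddCycle {n} (G : Graph n) : Set where
  field
    half  : ℕ
    len-ok : 1 ≤ half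
    cyc   : Fin (suc (2 * half)) → Fin n
    inj   : ∀ i j → cyc i ≡ cyc j → i ≡ j
    adj⇒  : ∀ i j → G (cyc i) (cyc j) ≡ true → Consec i j
    ⇒adj  : ∀ i j → Consec i j → G (cyc i) (cyc j) ≡ true

InP : ∀ {n} → Graph n → (Fin n → ℚ) → Set
InP G x =
  (∀ v → 0ℚ ℚ.≤ x v × x v ℚ.≤ 1ℚ) ×
  (∀ u v → G u v ≡ true → x u ℚ.+ x v ℚ.≤ 1ℚ) ×
  (∀ (C : InducedOddCycle G) →
     let open InducedOddCycle C in
     sumFin (λ i → x (cyc i)) ℚ.≤ (+ (2 * half)) / 2)

IndependentSet : ∀ {n} → Graph n → (Fin n → Bool) → Set
IndependentSet G S = ∀ i j → S i ≡ true → S j ≡ true → G i j ≡ false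

χ : Bool → ℚ
χ true = 1ℚ
χ false = 0ℚ

InStab : ∀ {n} → Graph n → (Fin n → ℚ) → Set
InStab {n} G x = Σ (List (ℚ × (Fin n → Bool))) λ L →
  (∀ {p} → p Data.List.Membership.Propositional.∈ L →
     0ℚ ℚ.≤ proj₁ p × IndependentSet G (proj₂ p)) ×
  sumList proj₁ L ≡ 1ℚ ×
  (∀ v → x v ≡ sumList (λ p → proj₁ p ℚ.* χ (proj₂ p v)) L)
  where import Data.List.Membership.Propositional

TPerfect : Gr → Set
TPerfect (n , G) = ∀ x → (InP G x → InStab G x) × (InStab G x → InP G x)

TImperfect : Gr → Set
TImperfect H = ¬ TPerfect H

CoreGraph : ∀ {n} → Graph n → Set
CoreGraph {n} G =
  ¬ (Σ Gr λ H → ProperTMinor H (n , G) × TImperfect H) ×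
  ¬ (Σ Gr λ H → ProperTMinor H (n , complement G) × TImperfect H)

Partitionable : ℕ → ℕ → Gr → Set
Partitionable p q (n , G) =
  n ≡ p * q ℕ.+ 1 ×
  (∀ (v : Fin n) →
    (Σ (Fin q → Fin p → Fin n) λ ind →
       (∀ a b → ind a b ≢ v) ×
       (∀ a b a' b' → ind a b ≡ ind a' b' → a ≡ a' × b ≡ b') ×
       (∀ u → u ≢ v → ∃ λ a → ∃ λ b → ind a b ≡ u) ×
       (∀ a b b' → b ≢ b' → G (ind a b) (ind a b') ≡ false)) ×
    (Σ (Fin p → Fin q → Fin n) λ cl →
       (∀ a b → cl a b ≢ v) ×
       (∀ a b a' b' → cl a b ≡ cl a' b' → a ≡ a' × b ≡ b') ×
       (∀ u → u ≢ v → ∃ λ a → ∃ λ b → cl a b ≡ u) ×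
       (∀ a b b' → b ≢ b' → G (cl a b) (cl a b') ≡ true)))

InducedSubgraphOf : ∀ {n} → Graph n → Gr → Set
InducedSubgraphOf {n} G (m , H) = Σ (Fin n → Fin m) λ f →
  (∀ i j → f i ≡ f j → i ≡ j) × (∀ i j → G i j ≡ H (f i) (f j))

_⊕_ : Fin 5 → ℕ → Fin 5
i ⊕ k = (toℕ i ℕ.+ k) mod 5

-- Indices start at 0: the hole is v₀…v₄ and uᵢ sees v_{i+2}, v_{i+3} and possibly vᵢ.
-- The hypotheses determine G up to seven adjacencies: the spokes uᵢvᵢ and the chords u₀u₂,
-- u₀u₃, u₁u₃ of the path u₀u₁u₂u₃.  Without chords, a new vertex u₄ adjacent to u₃, u₀, v₁
-- and v₂ closes the uᵢ into a second pentagon, and this 10-vertex graph is (3,3)-partitionable,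
-- as explicit stable-set and clique partitions show.  With a chord, either some vertex has
-- degree 6, or some G − d is t-imperfect: a vector with entries in {0, 1/3, 2/3} lies in
-- P(G − d) but has weight 7/3 on a set W with α(G[W]) ≤ 2, so it is not in STAB(G − d).
-- The 2⁷ cases are settled by evaluation.
{-# OPTIONS --safe #-}
module Submission where

open import Defs
open import Data.Bool using (true; false)
open import Data.Nat using (ℕ; _≤_)
open import Data.Fin using (Fin; toℕ; _≟_)
open import Data.Fin.Patterns using (0F; 1F; 2F; 3F)
open import Data.Nat.DivMod using (_mod_)
open import Data.Sum using (_⊎_; [_,_]′)
open import Data.Product using (Σ; _×_; proj₂)
open import Relation.Binary.PropositionalEquality using (_≡_)

import Algebra.Properties.CommutativeSemigroup as CommutativeSemigroupProperties
open import Algebra.Bundles using (CommutativeMonoid)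
open import Data.Bool as Bool using (Bool; not; _∧_; _∨_; T)
import Data.Bool.Properties as BoolP
open import Data.Empty using (⊥; ⊥-elim)
open import Data.Fin as Fin using (punchOut; splitAt; join)
open import Data.Fin.Patterns using (4F; 5F; 6F; 7F; 8F; 9F)
import Data.Fin.Properties as FinP
open import Data.Integer as ℤ using (+_)
import Data.Integer.Properties as ℤP
open import Data.Integer.Tactic.RingSolver using (solve-∀)
open import Data.List as List using (List; []; _∷_; length; map; lookup; filterᵇ; allFin)
import Data.List.Properties as LP
open import Data.List.Membership.Propositional using (_∈_)
open import Data.List.Membership.Propositional.Properties using (∈-lookup; ∈-filter⁺; ∈-allFin)
open import Data.List.Relation.Unary.All as All using (All; []; _∷_)
import Data.List.Relation.Unary.All.Properties as AllP
open import Data.List.Relation.Unary.Any as Any using (Any; here; there)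
import Data.List.Relation.Unary.Any.Properties as AnyP
open import Data.List.Relation.Unary.Unique.Propositional using (Unique; []; _∷_)
import Data.List.Relation.Unary.Unique.Propositional.Properties as UniqueP
open import Data.Nat as ℕ using (suc; _+_; _*_; _<_; z≤n; s≤s)
open import Data.Nat.ListAction using (sum)
import Data.Nat.Properties as ℕP
open import Data.Product using (∃; _,_; proj₁; uncurry)
open import Data.Rational as ℚ using (ℚ; 0ℚ; 1ℚ; _/_; toℚᵘ)
import Data.Rational.Properties as ℚP
open import Data.Rational.Unnormalised as ℚᵘ using (mkℚᵘ; *≡*; *≤*)
import Data.Rational.Unnormalised.Properties as ℚᵘP
open import Data.Sum using (inj₁; inj₂)
import Data.Sum as Sum
open import Data.Vec as Vec using (Vec; []; _∷_)
open import Function using (_∘_)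
open import Function.Bundles using (Equivalence)
open import Function.Definitions using (Injective)
open import Relation.Binary.PropositionalEquality using (_≢_; refl; sym; trans; cong; cong₂; subst; subst₂; module ≡-Reasoning)
open import Relation.Nullary using (¬_; Dec; yes; no; ⌊_⌋)
open import Relation.Nullary.Decidable using (T?; ¬?; _×-dec_; _→-dec_; map′; from-yes)

open CommutativeSemigroupProperties (CommutativeMonoid.commutativeSemigroup ℚP.+-0-commutativeMonoid)
  using () renaming (interchange to +-interchange)

-- Fractions of naturals

toℚᵘ-/ : ∀ a c → toℚᵘ (+ a / suc c) ℚᵘ.≃ mkℚᵘ (+ a) c
toℚᵘ-/ a c = ℚP.toℚᵘ-fromℚᵘ (mkℚᵘ (+ a) c)

≤-fraction⁺ : ∀ a b c d → a * suc d ≤ b * suc c → + a / suc c ℚ.≤ + b / suc d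
≤-fraction⁺ a b c d ad≤bc = ℚP.toℚᵘ-cancel-≤
  (ℚᵘP.≤-respˡ-≃ (ℚᵘP.≃-sym (toℚᵘ-/ a c)) (ℚᵘP.≤-respʳ-≃ (ℚᵘP.≃-sym (toℚᵘ-/ b d))
    (*≤* (subst₂ ℤ._≤_ (ℤP.pos-* a (suc d)) (ℤP.pos-* b (suc c)) (ℤ.+≤+ ad≤bc)))))

≤-fraction⁻ : ∀ a b c d → + a / suc c ℚ.≤ + b / suc d → a * suc d ≤ b * suc c
≤-fraction⁻ a b c d a/c≤b/d = ℤP.drop‿+≤+
  (subst₂ ℤ._≤_ (sym (ℤP.pos-* a (suc d))) (sym (ℤP.pos-* b (suc c)))
    (ℚᵘP.drop-*≤* (ℚᵘP.≤-respˡ-≃ (toℚᵘ-/ a c) (ℚᵘP.≤-respʳ-≃ (toℚᵘ-/ b d) (ℚP.toℚᵘ-mono-≤ a/c≤b/d)))))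

third : ℕ → ℚ
third n = + n / 3

third-+ : ∀ m n → third (m + n) ≡ third m ℚ.+ third n
third-+ m n = ℚP.toℚᵘ-injective (begin
  toℚᵘ (third (m + n))                  ≈⟨ toℚᵘ-/ (m + n) 2 ⟩
  mkℚᵘ (+ (m + n)) 2                    ≈⟨ *≡* numerators ⟩
  mkℚᵘ (+ m) 2 ℚᵘ.+ mkℚᵘ (+ n) 2        ≈⟨ ℚᵘP.+-cong (ℚᵘP.≃-sym (toℚᵘ-/ m 2)) (ℚᵘP.≃-sym (toℚᵘ-/ n 2)) ⟩
  toℚᵘ (third m) ℚᵘ.+ toℚᵘ (third n)    ≈⟨ ℚᵘP.≃-sym (ℚP.toℚᵘ-homo-+ (third m) (third n)) ⟩
  toℚᵘ (third m ℚ.+ third n)            ∎)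
  where
  open ℚᵘP.≃-Reasoning
  ring : ∀ x y → (x ℤ.+ y) ℤ.* + 9 ≡ (x ℤ.* + 3 ℤ.+ y ℤ.* + 3) ℤ.* + 3
  ring = solve-∀
  numerators : + (m + n) ℤ.* + 9 ≡ (+ m ℤ.* + 3 ℤ.+ + n ℤ.* + 3) ℤ.* + 3
  numerators = trans (cong (ℤ._* + 9) (ℤP.pos-+ m n)) (ring (+ m) (+ n))

third-mono-≤ : ∀ {m n} → m ≤ n → third m ℚ.≤ third n
third-mono-≤ {m} {n} m≤n = ≤-fraction⁺ m n 2 2 (ℕP.*-monoˡ-≤ 3 m≤n)

third-cancel-≤ : ∀ {m n} → third m ℚ.≤ third n → m ≤ n
third-cancel-≤ {m} {n} = ℕP.*-cancelʳ-≤ m n 3 ∘ ≤-fraction⁻ m n 2 2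

third-≤-half : ∀ {n} h → n ≤ 3 * h → third n ℚ.≤ + (2 * h) / 2
third-≤-half {n} h n≤3h = ≤-fraction⁺ n (2 * h) 2 1
  (subst (n * 2 ≤_) 3h*2≡2h*3 (ℕP.*-monoˡ-≤ 2 n≤3h))
  where
  3h*2≡2h*3 : 3 * h * 2 ≡ 2 * h * 3
  3h*2≡2h*3 = trans (ℕP.*-assoc 3 h 2) (trans (cong (3 *_) (ℕP.*-comm h 2)) (ℕP.*-comm 3 (2 * h)))

foldr≡sumList : ∀ {A : Set} (f : A → ℚ) xs → List.foldr (λ a s → f a ℚ.+ s) 0ℚ xs ≡ sumList f xs
foldr≡sumList f []       = refl
foldr≡sumList f (x ∷ xs) = cong (f x ℚ.+_) (foldr≡sumList f xs)

sumList-third : ∀ {A : Set} (r : A → ℕ) xs → sumList (third ∘ r) xs ≡ third (sum (map r xs))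
sumList-third r []       = refl
sumList-third r (x ∷ xs) = trans (cong (third (r x) ℚ.+_) (sumList-third r xs)) (sym (third-+ (r x) _))

sumList-cong : ∀ {A : Set} {f g : A → ℚ} → (∀ a → f a ≡ g a) → ∀ xs → sumList f xs ≡ sumList g xs
sumList-cong f≗g []       = refl
sumList-cong f≗g (x ∷ xs) = cong₂ ℚ._+_ (f≗g x) (sumList-cong f≗g xs)

sumList-zero : ∀ {A : Set} (xs : List A) → sumList (λ _ → 0ℚ) xs ≡ 0ℚ
sumList-zero []       = refl
sumList-zero (x ∷ xs) = trans (ℚP.+-identityˡ _) (sumList-zero xs)

sumList-+ : ∀ {A : Set} (f g : A → ℚ) xs → sumList (λ a → f a ℚ.+ g a) xs ≡ sumList f xs ℚ.+ sumList g xs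
sumList-+ f g []       = refl
sumList-+ f g (x ∷ xs) =
  trans (cong (f x ℚ.+ g x ℚ.+_) (sumList-+ f g xs)) (+-interchange (f x) (g x) (sumList f xs) (sumList g xs))

sumList-*ˡ : ∀ {A : Set} (c : ℚ) (f : A → ℚ) xs → sumList (λ a → c ℚ.* f a) xs ≡ c ℚ.* sumList f xs
sumList-*ˡ c f []       = sym (ℚP.*-zeroʳ c)
sumList-*ˡ c f (x ∷ xs) =
  trans (cong (c ℚ.* f x ℚ.+_) (sumList-*ˡ c f xs)) (sym (ℚP.*-distribˡ-+ c (f x) _))

sumList-*ʳ : ∀ {A : Set} (f : A → ℚ) (c : ℚ) xs → sumList (λ a → f a ℚ.* c) xs ≡ sumList f xs ℚ.* c
sumList-*ʳ f c []       = sym (ℚP.*-zeroˡ c)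
sumList-*ʳ f c (x ∷ xs) =
  trans (cong (f x ℚ.* c ℚ.+_) (sumList-*ʳ f c xs)) (sym (ℚP.*-distribʳ-+ c (f x) _))

sumList-comm : ∀ {A B : Set} (g : A → B → ℚ) xs ys →
  sumList (λ a → sumList (g a) ys) xs ≡ sumList (λ b → sumList (λ a → g a b) xs) ys
sumList-comm g []       ys = sym (sumList-zero ys)
sumList-comm g (x ∷ xs) ys = trans (cong (sumList (g x) ys ℚ.+_) (sumList-comm g xs ys))
  (sym (sumList-+ (g x) (λ b → sumList (λ a → g a b) xs) ys))

sumList-mono-≤ : ∀ {A : Set} {f g : A → ℚ} xs → (∀ {a} → a ∈ xs → f a ℚ.≤ g a) →
  sumList f xs ℚ.≤ sumList g xs
sumList-mono-≤ []       f≤g = ℚP.≤-refl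
sumList-mono-≤ (x ∷ xs) f≤g = ℚP.+-mono-≤ (f≤g (here refl)) (sumList-mono-≤ xs (f≤g ∘ there))

count : ∀ {A : Set} → (A → Bool) → List A → ℕ
count S xs = length (filterᵇ S xs)

sumList-χ : ∀ {A : Set} (S : A → Bool) xs → sumList (χ ∘ S) xs ≡ third (3 * count S xs)
sumList-χ S []       = refl
sumList-χ S (x ∷ xs) with S x
... | false = trans (ℚP.+-identityˡ _) (sumList-χ S xs)
... | true  = trans (cong (1ℚ ℚ.+_) (sumList-χ S xs))
                (trans (sym (third-+ 3 (3 * count S xs))) (cong third (sym (ℕP.*-suc 3 (count S xs)))))

sum-map-≤-length : ∀ {A : Set} {f : A → ℕ} {xs} → All (λ a → f a ≤ 1) xs → sum (map f xs) ≤ length xs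
sum-map-≤-length []           = z≤n
sum-map-≤-length (fx≤1 ∷ f≤1) = ℕP.+-mono-≤ fx≤1 (sum-map-≤-length f≤1)

sum-map-one-heavy : ∀ {A : Set} {f : A → ℕ} {xs} → Unique xs → (∀ a → f a ≤ 2) →
  (∀ a b → a ≢ b → f a + f b ≤ 3) → sum (map f xs) ≤ suc (length xs)
sum-map-one-heavy [] f≤2 light = z≤n
sum-map-one-heavy {f = f} {x ∷ xs} (x∉xs ∷ unique) f≤2 light with f x ℕP.≤? 1
... | yes fx≤1 = ℕP.+-mono-≤ fx≤1 (sum-map-one-heavy unique f≤2 light)
... | no  fx≰1 = ℕP.+-mono-≤ (f≤2 x) (sum-map-≤-length (All.map rest-light x∉xs))
  where
  rest-light : ∀ {b} → x ≢ b → f b ≤ 1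
  rest-light {b} x≢b = ℕP.+-cancelˡ-≤ 2 (f b) 1
    (ℕP.≤-trans (ℕP.+-monoˡ-≤ (f b) (ℕP.≰⇒> fx≰1)) (light x b x≢b))

2+2h≤3h : ∀ h → 2 ≤ h → 2 + 2 * h ≤ 3 * h
2+2h≤3h h 2≤h = ℕP.+-monoˡ-≤ (2 * h) 2≤h

-- Points of P(H) outside STAB(H)

AdmissibleThirds : ∀ {m} → Graph m → (Fin m → ℕ) → Set
AdmissibleThirds H r =
  (∀ a → r a ≤ 2) ×
  (∀ a b → a ≢ b → r a + r b ≤ 3) ×
  (∀ a b → H a b ≡ true → r a + r b ≤ 3) ×
  (∀ a b c → H a b ≡ true → H b c ≡ true → H a c ≡ true → r a + r b + r c ≤ 3)

admissible? : ∀ {m} (H : Graph m) r → Dec (AdmissibleThirds H r)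
admissible? H r =
  FinP.all? (λ a → r a ℕ.≤? 2) ×-dec
  FinP.all? (λ a → FinP.all? λ b → ¬? (a ≟ b) →-dec (r a + r b ℕ.≤? 3)) ×-dec
  FinP.all? (λ a → FinP.all? λ b → (H a b Bool.≟ true) →-dec (r a + r b ℕ.≤? 3)) ×-dec
  FinP.all? (λ a → FinP.all? λ b → FinP.all? λ c →
    (H a b Bool.≟ true) →-dec ((H b c Bool.≟ true) →-dec ((H a c Bool.≟ true) →-dec
      (r a + r b + r c ℕ.≤? 3))))

-- An induced odd cycle of length 2h+1 ≥ 5 has at most one vertex of weight 2/3, so its
-- weight is at most (2h+2)/3 ≤ h.
thirds-∈P : ∀ {m} {H : Graph m} {r} → AdmissibleThirds H r → InP H (third ∘ r)
thirds-∈P {m} {H} {r} (r≤2 , light , edge , triangle) = bounds , edges , odd-cycles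
  where
  bounds : ∀ a → 0ℚ ℚ.≤ third (r a) × third (r a) ℚ.≤ 1ℚ
  bounds a = third-mono-≤ {n = r a} z≤n , third-mono-≤ {r a} (ℕP.m≤n⇒m≤1+n (r≤2 a))

  edges : ∀ a b → H a b ≡ true → third (r a) ℚ.+ third (r b) ℚ.≤ 1ℚ
  edges a b ab = subst (ℚ._≤ 1ℚ) (third-+ (r a) (r b)) (third-mono-≤ {r a + r b} (edge a b ab))

  cycle-weight : ∀ h → (cyc : Fin (suc (2 * h)) → Fin m) → (∀ i j → cyc i ≡ cyc j → i ≡ j) →
    (∀ i j → Consec i j → H (cyc i) (cyc j) ≡ true) → 1 ≤ h →
    sum (map (r ∘ cyc) (allFin (suc (2 * h)))) ≤ 3 * h
  cycle-weight 1 cyc _ adj _ = subst (_≤ 3) (regroup (r (cyc 0F)) (r (cyc 1F)) (r (cyc 2F)))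
    (triangle _ _ _ (adj 0F 1F (inj₁ refl)) (adj 1F 2F (inj₁ refl)) (adj 0F 2F (inj₂ refl)))
    where
    regroup : ∀ a b c → a + b + c ≡ a + (b + (c + 0))
    regroup a b c = trans (ℕP.+-assoc a b c) (cong (λ t → a + (b + t)) (sym (ℕP.+-identityʳ c)))
  cycle-weight h@(suc (suc _)) cyc cyc-injective _ _ = begin
    sum (map (r ∘ cyc) (allFin k)) ≤⟨ sum-map-one-heavy (UniqueP.allFin⁺ k) (r≤2 ∘ cyc) cyc-light ⟩
    suc (length (allFin k))        ≡⟨ cong suc (LP.length-tabulate (λ i → i)) ⟩
    2 + 2 * h                      ≤⟨ 2+2h≤3h h (s≤s (s≤s z≤n)) ⟩
    3 * h                          ∎
    where
    open ℕP.≤-Reasoning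
    k = suc (2 * h)
    cyc-light : ∀ i j → i ≢ j → r (cyc i) + r (cyc j) ≤ 3
    cyc-light i j i≢j = light (cyc i) (cyc j) (i≢j ∘ cyc-injective i j)

  odd-cycles : ∀ (C : InducedOddCycle H) → let open InducedOddCycle C in
    sumFin (λ i → third (r (cyc i))) ℚ.≤ + (2 * half) / 2
  odd-cycles C = subst (ℚ._≤ _)
    (sym (trans (foldr≡sumList (third ∘ r ∘ cyc) (allFin _)) (sumList-third (r ∘ cyc) (allFin _))))
    (third-≤-half {sum (map (r ∘ cyc) (allFin _))} half (cycle-weight half cyc inj ⇒adj len-ok))
    where open InducedOddCycle C

InStab⇒sumList≤ : ∀ {m} {H : Graph m} {x} → InStab H x → ∀ hs c →
  (∀ S → IndependentSet H S → sumList (χ ∘ S) hs ℚ.≤ c) → sumList x hs ℚ.≤ c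
InStab⇒sumList≤ {x = x} (L , valid , total , x≡) hs c bound = begin
  sumList x hs                                            ≡⟨ sumList-cong x≡ hs ⟩
  sumList (λ h → sumList (λ p → λ· p ℚ.* χ (S p h)) L) hs ≡⟨ sumList-comm (λ h p → λ· p ℚ.* χ (S p h)) hs L ⟩
  sumList (λ p → sumList (λ h → λ· p ℚ.* χ (S p h)) hs) L ≡⟨ sumList-cong (λ p → sumList-*ˡ (λ· p) (χ ∘ S p) hs) L ⟩
  sumList (λ p → λ· p ℚ.* sumList (χ ∘ S p) hs) L         ≤⟨ sumList-mono-≤ L weighted-bound ⟩
  sumList (λ p → λ· p ℚ.* c) L                            ≡⟨ sumList-*ʳ λ· c L ⟩
  sumList λ· L ℚ.* c                                      ≡⟨ cong (ℚ._* c) total ⟩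
  1ℚ ℚ.* c                                                ≡⟨ ℚP.*-identityˡ c ⟩
  c                                                       ∎
  where
  open ℚP.≤-Reasoning
  λ· = proj₁
  S = proj₂
  weighted-bound : ∀ {p} → p ∈ L → λ· p ℚ.* sumList (χ ∘ S p) hs ℚ.≤ λ· p ℚ.* c
  weighted-bound {p} p∈L =
    ℚP.*-monoˡ-≤-nonNeg (λ· p) {{ℚ.nonNegative (proj₁ (valid p∈L))}} (bound (S p) (proj₂ (valid p∈L)))

module IndependenceBound {A : Set} (adjacent : A → A → Bool) where

  nonadjacent-to-all : A → List A → Bool
  nonadjacent-to-all a []       = true
  nonadjacent-to-all a (c ∷ cs) = not (adjacent a c) ∧ nonadjacent-to-all a cs

  -- `bounded B cs chosen`: every extension of `chosen` by pairwise nonadjacent members of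
  -- `cs` that are nonadjacent to `chosen` has at most B elements.
  bounded : ℕ → List A → List A → Bool
  bounded B []       chosen = length chosen ℕ.≤ᵇ B
  bounded B (a ∷ cs) chosen =
    bounded B cs chosen ∧ (not (nonadjacent-to-all a chosen) ∨ bounded B cs (a ∷ chosen))

  α≤ : ℕ → List A → Bool
  α≤ B cs = bounded B cs []

  module _ {X : Set} (label : X → A) (S : X → Bool)
           (S-independent : ∀ i j → S i ≡ true → S j ≡ true → adjacent (label i) (label j) ≡ false) where

    private
      Chosen : A → Set
      Chosen c = ∃ λ j → S j ≡ true × label j ≡ c

      selected-nonadjacent : ∀ i → S i ≡ true → ∀ cs → All Chosen cs → nonadjacent-to-all (label i) cs ≡ true
      selected-nonadjacent i Si []       []                  = refl
      selected-nonadjacent i Si (c ∷ cs) ((j , Sj , refl) ∷ chosen)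
        rewrite S-independent i j Si Sj = selected-nonadjacent i Si cs chosen

      ∧-true : ∀ {a b} → a ∧ b ≡ true → a ≡ true × b ≡ true
      ∧-true {true} {true} _ = refl , refl

      ∨-true : ∀ {a b} → not a ∨ b ≡ true → a ≡ true → b ≡ true
      ∨-true {true} {true} _ _ = refl

    bounded-sound : ∀ B hs chosen → All Chosen chosen → bounded B (map label hs) chosen ≡ true →
      count S hs + length chosen ≤ B
    bounded-sound B []       chosen _   ok = ℕP.≤ᵇ⇒≤ (length chosen) B (subst T (sym ok) _)
    bounded-sound B (i ∷ hs) chosen all ok with S i in Si | ∧-true {bounded B (map label hs) chosen} ok
    ... | false | skip , _    = bounded-sound B hs chosen all skip
    ... | true  | _    , take = subst (_≤ B) (ℕP.+-suc _ _)
      (bounded-sound B hs (label i ∷ chosen) ((i , Si , refl) ∷ all)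
        (∨-true take (selected-nonadjacent i Si chosen all)))

    α≤-sound : ∀ B hs → α≤ B (map label hs) ≡ true → count S hs ≤ B
    α≤-sound B hs ok = subst (_≤ B) (ℕP.+-identityʳ _) (bounded-sound B hs [] [] ok)

-- Vertex maps and t-minors

Unique⇒lookup-injective : ∀ {A : Set} {xs : List A} → Unique xs → Injective _≡_ _≡_ (lookup xs)
Unique⇒lookup-injective {xs = _ ∷ _} (x∉xs ∷ _) {Fin.zero}  {Fin.zero}  _  = refl
Unique⇒lookup-injective {xs = _ ∷ _} (x∉xs ∷ _) {Fin.zero}  {Fin.suc j} eq =
  ⊥-elim (All.lookup x∉xs (∈-lookup j) eq)
Unique⇒lookup-injective {xs = _ ∷ _} (x∉xs ∷ _) {Fin.suc i} {Fin.zero}  eq =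
  ⊥-elim (All.lookup x∉xs (∈-lookup i) (sym eq))
Unique⇒lookup-injective {xs = _ ∷ _} (_ ∷ unique) {Fin.suc i} {Fin.suc j} eq =
  cong Fin.suc (Unique⇒lookup-injective unique eq)

injective⇒surjective : ∀ {n} {f : Fin n → Fin n} → Injective _≡_ _≡_ f → ∀ y → ∃ λ x → f x ≡ y
injective⇒surjective {suc n} {f} f-injective y with FinP.any? (λ x → f x ≟ y)
... | yes found  = found
... | no  missed = ⊥-elim (ℕP.1+n≰n (FinP.injective⇒≤ punched-injective))
  where
  y≢f : ∀ x → y ≢ f x
  y≢f x y≡fx = missed (x , sym y≡fx)
  punched : Fin (suc n) → Fin n
  punched x = punchOut (y≢f x)
  punched-injective : Injective _≡_ _≡_ punched
  punched-injective = f-injective ∘ FinP.punchOut-injective (y≢f _) (y≢f _)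

map-preimage : ∀ {A B : Set} (f : A → B) {ys} → All (λ y → ∃ λ x → f x ≡ y) ys → ∃ λ xs → map f xs ≡ ys
map-preimage f []                = [] , refl
map-preimage f ((x , refl) ∷ ys) = let xs , fxs≡ys = map-preimage f ys in x ∷ xs , cong (f x ∷_) fxs≡ys

module Kept {n} (keep : Fin n → Bool) where

  kept : List (Fin n)
  kept = filterᵇ keep (allFin n)

  lookup-kept-injective : Injective _≡_ _≡_ (lookup kept)
  lookup-kept-injective = Unique⇒lookup-injective (UniqueP.filter⁺ (T? ∘ keep) (UniqueP.allFin⁺ n))

  lookup-kept-keep : ∀ i → keep (lookup kept i) ≡ true
  lookup-kept-keep i =
    Equivalence.to BoolP.T-≡ (All.lookup (AllP.all-filter (T? ∘ keep) (allFin n)) (∈-lookup i))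

  lookup-kept-onto : ∀ y → keep y ≡ true → ∃ λ i → lookup kept i ≡ y
  lookup-kept-onto y keep-y = Any.index y∈kept , sym (AnyP.lookup-index y∈kept)
    where
    y∈kept : y ∈ kept
    y∈kept = ∈-filter⁺ (T? ∘ keep) (∈-allFin y) (Equivalence.from BoolP.T-≡ keep-y)

≤-deg : ∀ {k n} (G : Graph n) c (f : Fin k → Fin n) → Injective _≡_ _≡_ f →
  (∀ i → G c (f i) ≡ true) → k ≤ deg G c
≤-deg G c f f-injective adjacent = FinP.injective⇒≤ position-injective
  where
  open Kept (G c)
  position : _ → Fin (length kept)
  position i = proj₁ (lookup-kept-onto (f i) (adjacent i))
  position-injective : Injective _≡_ _≡_ position
  position-injective {i} {j} eq = f-injective (begin
    f i                      ≡⟨ proj₂ (lookup-kept-onto (f i) (adjacent i)) ⟨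
    lookup kept (position i) ≡⟨ cong (lookup kept) eq ⟩
    lookup kept (position j) ≡⟨ proj₂ (lookup-kept-onto (f j) (adjacent j)) ⟩
    f j                      ∎)
    where open ≡-Reasoning

delete-shrinks : ∀ {n} (G : Graph n) y → proj₁ (delete G y) < n
delete-shrinks {n} G y = subst (proj₁ (delete G y) <_) (LP.length-tabulate (λ i → i))
  (LP.filter-notAll (T? ∘ keep) (allFin n) (Any.map (λ { refl → y-dropped }) (∈-allFin y)))
  where
  keep : Fin n → Bool
  keep i = not ⌊ i ≟ y ⌋
  y-dropped : ¬ T (keep y)
  y-dropped with y ≟ y
  ... | yes _   = λ ()
  ... | no  y≢y = ⊥-elim (y≢y refl)

open IndependenceBound using (α≤; α≤-sound)

RankViolation : ∀ {k} → Graph k → ℕ → (Fin k → ℕ) → List (Fin k) → Set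
RankViolation K B r W = AdmissibleThirds K r × α≤ K B W ≡ true × 3 * B < sum (map r W)

module InducedPullback {m k} {H : Graph m} {K : Graph k} (ρ : Fin m → Fin k)
  (ρ-injective : Injective _≡_ _≡_ ρ) (H≡K∘ρ : ∀ i j → H i j ≡ K (ρ i) (ρ j)) where

  private
    K-edge : ∀ {i j} → H i j ≡ true → K (ρ i) (ρ j) ≡ true
    K-edge {i} {j} = trans (sym (H≡K∘ρ i j))

  AdmissibleThirds-pullback : ∀ {r} → AdmissibleThirds K r → AdmissibleThirds H (r ∘ ρ)
  AdmissibleThirds-pullback (r≤2 , light , edge , triangle) =
    r≤2 ∘ ρ ,
    (λ i j i≢j → light (ρ i) (ρ j) (i≢j ∘ ρ-injective)) ,
    (λ i j ij → edge (ρ i) (ρ j) (K-edge ij)) ,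
    (λ i j l ij jl il → triangle (ρ i) (ρ j) (ρ l) (K-edge ij) (K-edge jl) (K-edge il))

  -- r/3 pulled back to H lies in P(H), but its weight on W exceeds B ≥ α(H[W]),
  -- which no point of STAB(H) can do.
  rank-violation⇒t-imperfect : ∀ {B r W} → RankViolation K B r W →
    All (λ a → ∃ λ i → ρ i ≡ a) W → TImperfect (m , H)
  rank-violation⇒t-imperfect {B} {r} {W} (admissible , α≤B , 3B<weight) W⊆ρ[H] perfect =
    ℕP.<⇒≱ 3B<weight (third-cancel-≤ (subst (ℚ._≤ third (3 * B)) weight-W
      (InStab⇒sumList≤ x∈STAB hs (third (3 * B)) vertex-bound)))
    where
    x : Fin m → ℚ
    x = third ∘ r ∘ ρ
    x∈STAB : InStab H x
    x∈STAB = proj₁ (perfect x) (thirds-∈P (AdmissibleThirds-pullback admissible))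
    hs : List (Fin m)
    hs = proj₁ (map-preimage ρ W⊆ρ[H])
    ρ[hs]≡W : map ρ hs ≡ W
    ρ[hs]≡W = proj₂ (map-preimage ρ W⊆ρ[H])
    weight-W : sumList x hs ≡ third (sum (map r W))
    weight-W = trans (sumList-third (r ∘ ρ) hs)
      (cong (third ∘ sum) (trans (LP.map-∘ hs) (cong (map r) ρ[hs]≡W)))
    vertex-bound : ∀ S → IndependentSet H S → sumList (χ ∘ S) hs ℚ.≤ third (3 * B)
    vertex-bound S independent = subst (ℚ._≤ third (3 * B)) (sym (sumList-χ S hs))
      (third-mono-≤ {3 * count S hs} (ℕP.*-monoʳ-≤ 3
        (α≤-sound K ρ S (λ i j Si Sj → trans (sym (H≡K∘ρ i j)) (independent i j Si Sj)) B hs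
          (subst (λ W → α≤ K B W ≡ true) (sym ρ[hs]≡W) α≤B))))

-- Each obstruction rules out core graphs of maximum degree at most 5 that are isomorphic
-- to K: a vertex of degree 6, or a t-imperfect vertex-deleted subgraph.
data Obstruction (n : ℕ) : Set where
  high-degree    : Fin n → Obstruction n
  rank-violation : (d : Fin n) (r : Vec ℕ n) (W : List (Fin n)) → Obstruction n

Refutes : ∀ {n} → Graph n → Obstruction n → Set
Refutes K (high-degree c)        = 6 ≤ deg K c
Refutes K (rank-violation d r W) = All (_≢ d) W × RankViolation K 2 (Vec.lookup r) W

refutes? : ∀ {n} (K : Graph n) o → Dec (Refutes K o)
refutes? K (high-degree c)        = 6 ℕ.≤? deg K c
refutes? K (rank-violation d r W) =
  All.all? (λ a → ¬? (a ≟ d)) W ×-dec admissible? K (Vec.lookup r) ×-dec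
  (α≤ K 2 W Bool.≟ true) ×-dec (3 * 2 ℕ.<? sum (map (Vec.lookup r) W))

module Relabelled {n} (G K : Graph n) (w : Fin n → Fin n) (w-injective : Injective _≡_ _≡_ w)
  (relabel : ∀ a b → G (w a) (w b) ≡ K a b) where

  w⁻¹ : Fin n → Fin n
  w⁻¹ y = proj₁ (injective⇒surjective w-injective y)

  w∘w⁻¹ : ∀ y → w (w⁻¹ y) ≡ y
  w∘w⁻¹ y = proj₂ (injective⇒surjective w-injective y)

  w⁻¹∘w : ∀ a → w⁻¹ (w a) ≡ a
  w⁻¹∘w a = w-injective (w∘w⁻¹ (w a))

  w⁻¹-injective : Injective _≡_ _≡_ w⁻¹
  w⁻¹-injective {x} {y} eq = trans (sym (w∘w⁻¹ x)) (trans (cong w eq) (w∘w⁻¹ y))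

  G≡K∘w⁻¹ : ∀ x y → G x y ≡ K (w⁻¹ x) (w⁻¹ y)
  G≡K∘w⁻¹ x y = subst₂ (λ p q → G p q ≡ K (w⁻¹ x) (w⁻¹ y)) (w∘w⁻¹ x) (w∘w⁻¹ y) (relabel _ _)

  deg-≤ : ∀ c → deg K c ≤ deg G (w c)
  deg-≤ c = ≤-deg G (w c) (w ∘ lookup kept) (lookup-kept-injective ∘ w-injective)
    (λ i → trans (relabel c _) (lookup-kept-keep i))
    where open Kept (K c)

  induced-in : ∀ {m} (L : Graph m) (e : Fin n → Fin m) → Injective _≡_ _≡_ e →
    (∀ a b → K a b ≡ L (e a) (e b)) → InducedSubgraphOf G (m , L)
  induced-in L e e-injective K≡L∘e =
    e ∘ w⁻¹ , (λ i j eq → w⁻¹-injective (e-injective eq)) , λ i j → trans (G≡K∘w⁻¹ i j) (K≡L∘e _ _)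

  deletion-t-imperfect : ∀ d {B r W} → RankViolation K B r W → All (_≢ d) W → TImperfect (delete G (w d))
  deletion-t-imperfect d violation W∌d = rank-violation⇒t-imperfect violation (All.map preimage W∌d)
    where
    open Kept (λ i → not ⌊ i ≟ w d ⌋)
    ρ : Fin (length kept) → Fin n
    ρ = w⁻¹ ∘ lookup kept
    open InducedPullback {K = K} ρ (lookup-kept-injective ∘ w⁻¹-injective)
      (λ i j → G≡K∘w⁻¹ (lookup kept i) (lookup kept j))
    preimage : ∀ {a} → a ≢ d → ∃ λ i → ρ i ≡ a
    preimage {a} a≢d with lookup-kept-onto (w a) wa-kept
      where
      wa-kept : not ⌊ w a ≟ w d ⌋ ≡ true
      wa-kept with w a ≟ w d
      ... | yes wa≡wd = ⊥-elim (a≢d (w-injective wa≡wd))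
      ... | no  _     = refl
    ... | i , σi≡wa = i , trans (cong w⁻¹ σi≡wa) (w⁻¹∘w a)

  refute : CoreGraph G → (∀ x → deg G x ≤ 5) → ∀ o → Refutes K o → ⊥
  refute _ Δ≤5 (high-degree c) 6≤deg = ℕP.1+n≰n (ℕP.≤-trans (ℕP.≤-trans 6≤deg (deg-≤ c)) (Δ≤5 (w c)))
  refute core _ (rank-violation d r W) (W∌d , violation) =
    proj₁ core (delete G (w d) , (tm-del (w d) tm-refl , delete-shrinks G (w d)) ,
                deletion-t-imperfect d violation W∌d)

-- Partitionable graphs

Partitions : ∀ {n k l} → Fin n → (Fin k → Fin l → Fin n) → Set
Partitions v t =
  (∀ a b → t a b ≢ v) ×
  (∀ a b a′ b′ → t a b ≡ t a′ b′ → a ≡ a′ × b ≡ b′) ×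
  (∀ y → y ≢ v → ∃ λ a → ∃ λ b → t a b ≡ y)

partitions? : ∀ {n k l} (v : Fin n) (t : Fin k → Fin l → Fin n) → Dec (Partitions v t)
partitions? v t =
  FinP.all? (λ a → FinP.all? λ b → ¬? (t a b ≟ v)) ×-dec
  FinP.all? (λ a → FinP.all? λ b → FinP.all? λ a′ → FinP.all? λ b′ →
    (t a b ≟ t a′ b′) →-dec ((a ≟ a′) ×-dec (b ≟ b′))) ×-dec
  FinP.all? (λ y → ¬? (y ≟ v) →-dec FinP.any? λ a → FinP.any? λ b → t a b ≟ y)

Homogeneous : ∀ {n k l} → Graph n → Bool → (Fin k → Fin l → Fin n) → Set
Homogeneous G adjacent t = ∀ a b b′ → b ≢ b′ → G (t a b) (t a b′) ≡ adjacent

homogeneous? : ∀ {n k l} (G : Graph n) adjacent (t : Fin k → Fin l → Fin n) →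
  Dec (Homogeneous G adjacent t)
homogeneous? G adjacent t = FinP.all? λ a → FinP.all? λ b → FinP.all? λ b′ →
  ¬? (b ≟ b′) →-dec (G (t a b) (t a b′) Bool.≟ adjacent)

partitionable : ∀ {p q n} (G : Graph n) → n ≡ p * q + 1 →
  (stable : Fin n → Fin q → Fin p → Fin n) → (∀ v → Partitions v (stable v) × Homogeneous G false (stable v)) →
  (clique : Fin n → Fin p → Fin q → Fin n) → (∀ v → Partitions v (clique v) × Homogeneous G true (clique v)) →
  Partitionable p q (n , G)
partitionable G n≡pq+1 stable stable-ok clique clique-ok = n≡pq+1 , λ v →
  let (avoids , injective , covers) , independent = stable-ok v
      (avoids′ , injective′ , covers′) , complete = clique-ok v
  in (stable v , avoids , injective , covers , independent) ,
     (clique v , avoids′ , injective′ , covers′ , complete)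

isSimple? : ∀ {n} (G : Graph n) → Dec (IsSimple G)
isSimple? G = FinP.all? (λ i → FinP.all? λ j → G i j Bool.≟ G j i) ×-dec FinP.all? (λ i → G i i Bool.≟ false)

-- The configurations

∀-Bool? : {P : Bool → Set} → (∀ b → Dec (P b)) → Dec (∀ b → P b)
∀-Bool? P? =
  map′ (λ { (P-false , P-true) → λ { false → P-false ; true → P-true } }) (λ P-all → P-all false , P-all true)
    (P? false ×-dec P? true)

-- The adjacencies of the configuration left open by the hypotheses: uᵢvᵢ for i < 4, and
-- the chords u₀u₂, u₀u₃, u₁u₃ of the path u₀u₁u₂u₃.
record Profile : Set where
  constructor profile
  field
    spoke₀ spoke₁ spoke₂ spoke₃ : Bool
    chord₀₂ chord₀₃ chord₁₃     : Bool
open Profile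

∀-Profile? : {P : Profile → Set} → (∀ p → Dec (P p)) → Dec (∀ p → P p)
∀-Profile? P? =
  map′ (λ P-all → λ { (profile a b c d e f g) → P-all a b c d e f g })
       (λ P-all a b c d e f g → P-all (profile a b c d e f g))
    (∀-Bool? λ a → ∀-Bool? λ b → ∀-Bool? λ c → ∀-Bool? λ d → ∀-Bool? λ e → ∀-Bool? λ f → ∀-Bool? λ g →
      P? (profile a b c d e f g))

chords : Profile → Bool
chords p = chord₀₂ p ∨ chord₀₃ p ∨ chord₁₃ p

spoke : Profile → Fin 5 → Bool
spoke p 0F = spoke₀ p
spoke p 1F = spoke₁ p
spoke p 2F = spoke₂ p
spoke p 3F = spoke₃ p
spoke p 4F = false

chord : Profile → Fin 5 → Fin 5 → Bool
chord p 0F 2F = chord₀₂ p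
chord p 2F 0F = chord₀₂ p
chord p 0F 3F = chord₀₃ p
chord p 3F 0F = chord₀₃ p
chord p 1F 3F = chord₁₃ p
chord p 3F 1F = chord₁₃ p
chord p _  _  = false

cyclic-adjacent : Fin 5 → Fin 5 → Bool
cyclic-adjacent j k = ⌊ k ≟ j ⊕ 1 ⌋ ∨ ⌊ j ≟ k ⊕ 1 ⌋

spoke-adjacent : Profile → Fin 5 → Fin 5 → Bool
spoke-adjacent p i j = ⌊ j ≟ i ⊕ 2 ⌋ ∨ ⌊ j ≟ i ⊕ 3 ⌋ ∨ ⌊ j ≟ i ⌋ ∧ spoke p i

-- inj₁ j is vⱼ and inj₂ i is uᵢ; u₄ closes u₀u₁u₂u₃ into a second pentagon and is
-- attached to the hole like the other uᵢ, but without the optional spoke u₄v₄.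
layout : Profile → Fin 5 ⊎ Fin 5 → Fin 5 ⊎ Fin 5 → Bool
layout p (inj₁ j) (inj₁ k)  = cyclic-adjacent j k
layout p (inj₁ j) (inj₂ i)  = spoke-adjacent p i j
layout p (inj₂ i) (inj₁ j)  = spoke-adjacent p i j
layout p (inj₂ i) (inj₂ i′) = cyclic-adjacent i i′ ∨ chord p i i′

twoPentagons : Profile → Graph 10
twoPentagons p a b = layout p (splitAt 5 a) (splitAt 5 b)

ι : Fin 4 → Fin 5
ι i = toℕ i mod 5

position : Fin 9 → Fin 5 ⊎ Fin 5
position = Sum.map₂ ι ∘ splitAt 5

configuration : Profile → Graph 9
configuration p a b = layout p (position a) (position b)

embed : Fin 9 → Fin 10
embed = join 5 5 ∘ position

embed-injective : Injective _≡_ _≡_ embed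
embed-injective {a} {b} = from-yes (FinP.all? λ a → FinP.all? λ b → (embed a ≟ embed b) →-dec (a ≟ b)) a b

configuration-embeds : ∀ p a b → configuration p a b ≡ twoPentagons p (embed a) (embed b)
configuration-embeds p a b =
  sym (cong₂ (layout p) (FinP.splitAt-join 5 5 (position a)) (FinP.splitAt-join 5 5 (position b)))

⟨_,_,_⟩ : ∀ {A : Set} → A → A → A → Fin 3 → A
⟨ x , y , z ⟩ 0F = x
⟨ x , y , z ⟩ 1F = y
⟨ x , y , z ⟩ 2F = z

-- Vertex j < 5 is vⱼ and vertex 5 + i is uᵢ.
stableBlocks : Fin 10 → Fin 3 → Fin 3 → Fin 10
stableBlocks 0F = ⟨ ⟨ 1F , 4F , 5F ⟩ , ⟨ 2F , 6F , 8F ⟩ , ⟨ 3F , 7F , 9F ⟩ ⟩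
stableBlocks 1F = ⟨ ⟨ 0F , 2F , 6F ⟩ , ⟨ 3F , 7F , 9F ⟩ , ⟨ 4F , 5F , 8F ⟩ ⟩
stableBlocks 2F = ⟨ ⟨ 0F , 6F , 9F ⟩ , ⟨ 1F , 3F , 7F ⟩ , ⟨ 4F , 5F , 8F ⟩ ⟩
stableBlocks 3F = ⟨ ⟨ 0F , 6F , 9F ⟩ , ⟨ 1F , 5F , 7F ⟩ , ⟨ 2F , 4F , 8F ⟩ ⟩
stableBlocks 4F = ⟨ ⟨ 0F , 3F , 9F ⟩ , ⟨ 1F , 5F , 7F ⟩ , ⟨ 2F , 6F , 8F ⟩ ⟩
stableBlocks 5F = ⟨ ⟨ 0F , 6F , 9F ⟩ , ⟨ 1F , 3F , 7F ⟩ , ⟨ 2F , 4F , 8F ⟩ ⟩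
stableBlocks 6F = ⟨ ⟨ 0F , 3F , 9F ⟩ , ⟨ 1F , 5F , 7F ⟩ , ⟨ 2F , 4F , 8F ⟩ ⟩
stableBlocks 7F = ⟨ ⟨ 0F , 3F , 9F ⟩ , ⟨ 1F , 4F , 5F ⟩ , ⟨ 2F , 6F , 8F ⟩ ⟩
stableBlocks 8F = ⟨ ⟨ 0F , 2F , 6F ⟩ , ⟨ 1F , 4F , 5F ⟩ , ⟨ 3F , 7F , 9F ⟩ ⟩
stableBlocks 9F = ⟨ ⟨ 0F , 2F , 6F ⟩ , ⟨ 1F , 3F , 7F ⟩ , ⟨ 4F , 5F , 8F ⟩ ⟩

cliqueBlocks : Fin 10 → Fin 3 → Fin 3 → Fin 10
cliqueBlocks 0F = ⟨ ⟨ 1F , 8F , 9F ⟩ , ⟨ 2F , 3F , 5F ⟩ , ⟨ 4F , 6F , 7F ⟩ ⟩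
cliqueBlocks 1F = ⟨ ⟨ 0F , 7F , 8F ⟩ , ⟨ 2F , 5F , 9F ⟩ , ⟨ 3F , 4F , 6F ⟩ ⟩
cliqueBlocks 2F = ⟨ ⟨ 0F , 4F , 7F ⟩ , ⟨ 1F , 8F , 9F ⟩ , ⟨ 3F , 5F , 6F ⟩ ⟩
cliqueBlocks 3F = ⟨ ⟨ 0F , 1F , 8F ⟩ , ⟨ 2F , 5F , 9F ⟩ , ⟨ 4F , 6F , 7F ⟩ ⟩
cliqueBlocks 4F = ⟨ ⟨ 0F , 7F , 8F ⟩ , ⟨ 1F , 2F , 9F ⟩ , ⟨ 3F , 5F , 6F ⟩ ⟩
cliqueBlocks 5F = ⟨ ⟨ 0F , 7F , 8F ⟩ , ⟨ 1F , 2F , 9F ⟩ , ⟨ 3F , 4F , 6F ⟩ ⟩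
cliqueBlocks 6F = ⟨ ⟨ 0F , 4F , 7F ⟩ , ⟨ 1F , 8F , 9F ⟩ , ⟨ 2F , 3F , 5F ⟩ ⟩
cliqueBlocks 7F = ⟨ ⟨ 0F , 1F , 8F ⟩ , ⟨ 2F , 5F , 9F ⟩ , ⟨ 3F , 4F , 6F ⟩ ⟩
cliqueBlocks 8F = ⟨ ⟨ 0F , 4F , 7F ⟩ , ⟨ 1F , 2F , 9F ⟩ , ⟨ 3F , 5F , 6F ⟩ ⟩
cliqueBlocks 9F = ⟨ ⟨ 0F , 1F , 8F ⟩ , ⟨ 2F , 3F , 5F ⟩ , ⟨ 4F , 6F , 7F ⟩ ⟩

stableBlocks-partition : ∀ v → Partitions v (stableBlocks v)
stableBlocks-partition = from-yes (FinP.all? λ v → partitions? v (stableBlocks v))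

cliqueBlocks-partition : ∀ v → Partitions v (cliqueBlocks v)
cliqueBlocks-partition = from-yes (FinP.all? λ v → partitions? v (cliqueBlocks v))

chordless-twoPentagons : ∀ p → chords p ≡ false →
  IsSimple (twoPentagons p) ×
  (∀ v → Homogeneous (twoPentagons p) false (stableBlocks v)) ×
  (∀ v → Homogeneous (twoPentagons p) true (cliqueBlocks v))
chordless-twoPentagons = from-yes (∀-Profile? λ p → (chords p Bool.≟ false) →-dec
  (isSimple? (twoPentagons p) ×-dec
   FinP.all? (λ v → homogeneous? (twoPentagons p) false (stableBlocks v)) ×-dec
   FinP.all? (λ v → homogeneous? (twoPentagons p) true (cliqueBlocks v))))

twoPentagons-partitionable : ∀ p → chords p ≡ false → Partitionable 3 3 (10 , twoPentagons p)
twoPentagons-partitionable p chordless =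
  let _ , stable-independent , clique-complete = chordless-twoPentagons p chordless in
  partitionable (twoPentagons p) refl
    stableBlocks (λ v → stableBlocks-partition v , stable-independent v)
    cliqueBlocks (λ v → cliqueBlocks-partition v , clique-complete v)

obstructions : List (Obstruction 9)
obstructions =
  high-degree 5F ∷ high-degree 6F ∷ high-degree 7F ∷ high-degree 8F ∷
  rank-violation 1F (1 ∷ 0 ∷ 0 ∷ 1 ∷ 1 ∷ 1 ∷ 1 ∷ 1 ∷ 1 ∷ []) (0F ∷ 3F ∷ 4F ∷ 5F ∷ 6F ∷ 7F ∷ 8F ∷ []) ∷
  rank-violation 0F (0 ∷ 2 ∷ 1 ∷ 1 ∷ 0 ∷ 1 ∷ 1 ∷ 0 ∷ 1 ∷ []) (1F ∷ 2F ∷ 3F ∷ 5F ∷ 6F ∷ 8F ∷ []) ∷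
  rank-violation 3F (1 ∷ 1 ∷ 2 ∷ 0 ∷ 0 ∷ 1 ∷ 0 ∷ 1 ∷ 1 ∷ []) (0F ∷ 1F ∷ 2F ∷ 5F ∷ 7F ∷ 8F ∷ []) ∷ []

chorded-obstructed : ∀ p → chords p ≡ true → Any (Refutes (configuration p)) obstructions
chorded-obstructed = from-yes (∀-Profile? λ p → (chords p Bool.≟ true) →-dec
  Any.any? (refutes? (configuration p)) obstructions)

module _ (G : Graph 9) (core : CoreGraph G) (Δ≤5 : ∀ x → deg G x ≤ 5) (p : Profile)
  (w : Fin 9 → Fin 9) (w-injective : Injective _≡_ _≡_ w)
  (relabel : ∀ a b → G (w a) (w b) ≡ configuration p a b) where

  open Relabelled G (configuration p) w w-injective relabel

  core-configuration-embeds : Σ Gr λ H → IsSimple (proj₂ H) × Partitionable 3 3 H × InducedSubgraphOf G H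
  core-configuration-embeds with chords p in chords≡
  ... | false = (10 , twoPentagons p) , proj₁ (chordless-twoPentagons p chords≡) ,
                twoPentagons-partitionable p chords≡ ,
                induced-in (twoPentagons p) embed embed-injective (configuration-embeds p)
  ... | true  = ⊥-elim (uncurry (refute core Δ≤5) (Any.satisfied (chorded-obstructed p chords≡)))

module Configuration (G : Graph 9) (simple : IsSimple G) (v : Fin 5 → Fin 9) (u : Fin 4 → Fin 9)
  (distinct : ∀ (a b : Fin 5 ⊎ Fin 4) → [ v , u ]′ a ≡ [ v , u ]′ b → a ≡ b)
  (hole-only : ∀ j k → G (v j) (v k) ≡ true → k ≡ j ⊕ 1 ⊎ j ≡ k ⊕ 1)
  (hole : ∀ j → G (v j) (v (j ⊕ 1)) ≡ true)
  (spoke-2 : ∀ i → G (u i) (v (ι i ⊕ 2)) ≡ true)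
  (spoke-3 : ∀ i → G (u i) (v (ι i ⊕ 3)) ≡ true)
  (spoke-only : ∀ i j → G (u i) (v j) ≡ true → j ≡ ι i ⊎ j ≡ ι i ⊕ 2 ⊎ j ≡ ι i ⊕ 3)
  (path₀₁ : G (u 0F) (u 1F) ≡ true) (path₁₂ : G (u 1F) (u 2F) ≡ true) (path₂₃ : G (u 2F) (u 3F) ≡ true)
  where

  profileOf : Profile
  profileOf = profile (G (u 0F) (v 0F)) (G (u 1F) (v 1F)) (G (u 2F) (v 2F)) (G (u 3F) (v 3F))
                      (G (u 0F) (u 2F)) (G (u 0F) (u 3F)) (G (u 1F) (u 3F))

  w : Fin 9 → Fin 9
  w = [ v , u ]′ ∘ splitAt 5

  w-injective : Injective _≡_ _≡_ w
  w-injective {a} {b} wa≡wb = begin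
    a                     ≡⟨ FinP.join-splitAt 5 4 a ⟨
    join 5 4 (splitAt 5 a) ≡⟨ cong (join 5 4) (distinct (splitAt 5 a) (splitAt 5 b) wa≡wb) ⟩
    join 5 4 (splitAt 5 b) ≡⟨ FinP.join-splitAt 5 4 b ⟩
    b                     ∎
    where open ≡-Reasoning

  private
    symmetric : ∀ x y → G x y ≡ G y x
    symmetric = proj₁ simple

    loop : ∀ x → G x x ≡ false
    loop = proj₂ simple

  hole-adjacency : ∀ j k → G (v j) (v k) ≡ cyclic-adjacent j k
  hole-adjacency j k with k ≟ j ⊕ 1 | j ≟ k ⊕ 1
  ... | yes refl | _        = hole j
  ... | no _     | yes refl = trans (symmetric _ _) (hole k)
  ... | no k≢j+1 | no j≢k+1 = BoolP.¬-not λ e → [ k≢j+1 , j≢k+1 ]′ (hole-only j k e)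

  own-spoke : ∀ i → G (u i) (v (ι i)) ≡ spoke profileOf (ι i)
  own-spoke 0F = refl
  own-spoke 1F = refl
  own-spoke 2F = refl
  own-spoke 3F = refl

  spoke-adjacency : ∀ i j → G (u i) (v j) ≡ spoke-adjacent profileOf (ι i) j
  spoke-adjacency i j with j ≟ ι i ⊕ 2 | j ≟ ι i ⊕ 3 | j ≟ ι i
  ... | yes refl | _        | _        = spoke-2 i
  ... | no _     | yes refl | _        = spoke-3 i
  ... | no _     | no _     | yes refl = own-spoke i
  ... | no j≢i+2 | no j≢i+3 | no j≢i   = BoolP.¬-not λ e → [ j≢i , [ j≢i+2 , j≢i+3 ]′ ]′ (spoke-only i j e)

  path-adjacency : ∀ i i′ → G (u i) (u i′) ≡ (cyclic-adjacent (ι i) (ι i′) ∨ chord profileOf (ι i) (ι i′))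
  path-adjacency 0F 0F = loop _
  path-adjacency 0F 1F = path₀₁
  path-adjacency 0F 2F = refl
  path-adjacency 0F 3F = refl
  path-adjacency 1F 0F = trans (symmetric _ _) path₀₁
  path-adjacency 1F 1F = loop _
  path-adjacency 1F 2F = path₁₂
  path-adjacency 1F 3F = refl
  path-adjacency 2F 0F = symmetric _ _
  path-adjacency 2F 1F = trans (symmetric _ _) path₁₂
  path-adjacency 2F 2F = loop _
  path-adjacency 2F 3F = path₂₃
  path-adjacency 3F 0F = symmetric _ _
  path-adjacency 3F 1F = symmetric _ _
  path-adjacency 3F 2F = trans (symmetric _ _) path₂₃
  path-adjacency 3F 3F = loop _

  relabel : ∀ a b → G (w a) (w b) ≡ configuration profileOf a b
  relabel a b with splitAt 5 a | splitAt 5 b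
  ... | inj₁ j | inj₁ k  = hole-adjacency j k
  ... | inj₁ j | inj₂ i  = trans (symmetric _ _) (spoke-adjacency i j)
  ... | inj₂ i | inj₁ j  = spoke-adjacency i j
  ... | inj₂ i | inj₂ i′ = path-adjacency i i′

proposition11 : (G : Graph 9) → IsSimple G → CoreGraph G →
    (∀ x → 3 ≤ deg G x) → (∀ x → deg G x ≤ 5) →
    (v : Fin 5 → Fin 9) (u : Fin 4 → Fin 9) →
    (∀ (a b : Fin 5 ⊎ Fin 4) → [ v , u ]′ a ≡ [ v , u ]′ b → a ≡ b) →
    (∀ j k → G (v j) (v k) ≡ true → k ≡ j ⊕ 1 ⊎ j ≡ k ⊕ 1) →
    (∀ j → G (v j) (v (j ⊕ 1)) ≡ true) →
    (∀ (i : Fin 4) → G (u i) (v ((toℕ i mod 5) ⊕ 2)) ≡ true) →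
    (∀ (i : Fin 4) → G (u i) (v ((toℕ i mod 5) ⊕ 3)) ≡ true) →
    (∀ (i : Fin 4) (j : Fin 5) → G (u i) (v j) ≡ true →
       j ≡ (toℕ i mod 5) ⊎ j ≡ (toℕ i mod 5) ⊕ 2 ⊎ j ≡ (toℕ i mod 5) ⊕ 3) →
    G (u 0F) (u 1F) ≡ true → G (u 1F) (u 2F) ≡ true → G (u 2F) (u 3F) ≡ true →
    Σ Gr λ H → IsSimple (proj₂ H) × Partitionable 3 3 H × InducedSubgraphOf G H
proposition11 G simple core _ Δ≤5 v u distinct hole-only hole spoke-2 spoke-3 spoke-only path₀₁ path₁₂ path₂₃ =
  core-configuration-embeds G core Δ≤5 profileOf w w-injective relabel
  where open Configuration G simple v u distinct hole-only hole spoke-2 spoke-3 spoke-only path₀₁ path₁₂ path₂₃
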